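{- Let $a,b$ be integers and let $H$ be a skew-regular quaternary Hadamard matrix of order $n=a^2+b^2$ with row sum $a+bi$. Then the row sums of the skew-type matrix \[ K=\begin{bmatrix} H & iH\\ iH^* & H^*\end{bmatrix} \] belong to the set $\{\,a-b+(a+b)i,\; a+b+(a-b)i\,\}$.
   Context: A quaternary Hadamard matrix of order $n$ is an $n\times n$ matrix $H$ with entries in $\{1,-1,i,-i\}$ such that $HH^*=nI_n$, where $H^*$ is the conjugate transpose. A matrix is of skew type if it can be written as $I+Q$ with $Q^*=-Q$. A quaternary Hadamard matrix is skew-regular if it is of skew type and all its row sums are equal to the same complex number (its row sum). -}

module Defs where

open import Data.Nat using (ℕ; zero; suc)
open import Data.Integer as ℤ using (ℤ; +_; -_; _-_)
open import Data.Fin using (Fin; zero; suc; splitAt)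
open import Data.Sum using (_⊎_; inj₁; inj₂)
open import Data.Product using (_×_)
open import Relation.Binary.PropositionalEquality using (_≡_)

record ℤ[i] : Set where
  constructor ⟨_,_⟩
  field
    re : ℤ
    im : ℤ
open ℤ[i] public

infixl 6 _⊕_
_⊕_ : ℤ[i] → ℤ[i] → ℤ[i]
⟨ a , b ⟩ ⊕ ⟨ c , d ⟩ = ⟨ a ℤ.+ c , b ℤ.+ d ⟩

infixl 7 _⊗_
_⊗_ : ℤ[i] → ℤ[i] → ℤ[i]
⟨ a , b ⟩ ⊗ ⟨ c , d ⟩ = ⟨ a ℤ.* c - b ℤ.* d , a ℤ.* d ℤ.+ b ℤ.* c ⟩

neg : ℤ[i] → ℤ[i]
neg ⟨ a , b ⟩ = ⟨ - a , - b ⟩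

conj : ℤ[i] → ℤ[i]
conj ⟨ a , b ⟩ = ⟨ a , - b ⟩

0ᵍ 1ᵍ iᵍ : ℤ[i]
0ᵍ = ⟨ + 0 , + 0 ⟩
1ᵍ = ⟨ + 1 , + 0 ⟩
iᵍ = ⟨ + 0 , + 1 ⟩

fromℕ : ℕ → ℤ[i]
fromℕ m = ⟨ + m , + 0 ⟩

sumᵍ : (n : ℕ) → (Fin n → ℤ[i]) → ℤ[i]
sumᵍ zero    f = 0ᵍ
sumᵍ (suc n) f = f zero ⊕ sumᵍ n (λ j → f (suc j))

Matrix : ℕ → Set
Matrix n = Fin n → Fin n → ℤ[i]

δ : {n : ℕ} → Fin n → Fin n → ℤ[i]
δ zero    zero    = 1ᵍ
δ zero    (suc _) = 0ᵍ
δ (suc _) zero    = 0ᵍ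
δ (suc j) (suc k) = δ j k

_* : {n : ℕ} → Matrix n → Matrix n
(M *) j k = conj (M k j)

mul : {n : ℕ} → Matrix n → Matrix n → Matrix n
mul {n} A B j k = sumᵍ n (λ l → A j l ⊗ B l k)

scale : {n : ℕ} → ℤ[i] → Matrix n → Matrix n
scale c M j k = c ⊗ M j k

IsQuaternaryEntry : ℤ[i] → Set
IsQuaternaryEntry z = (z ≡ 1ᵍ ⊎ z ≡ neg 1ᵍ) ⊎ (z ≡ iᵍ ⊎ z ≡ neg iᵍ)

IsQuaternaryHadamard : (n : ℕ) → Matrix n → Set
IsQuaternaryHadamard n H =
  (∀ j k → IsQuaternaryEntry (H j k)) ×
  (∀ j k → mul H (H *) j k ≡ fromℕ n ⊗ δ j k)

IsSkewType : (n : ℕ) → Matrix n → Set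
IsSkewType n M = ∀ j k → conj (Q k j) ≡ neg (Q j k)
  where
    Q : Matrix n
    Q j k = M j k ⊕ neg (δ j k)

rowSum : {n : ℕ} → Matrix n → Fin n → ℤ[i]
rowSum {n} M j = sumᵍ n (M j)

IsSkewRegularQH : (n : ℕ) → Matrix n → ℤ[i] → Set
IsSkewRegularQH n H s =
  IsQuaternaryHadamard n H × IsSkewType n H × (∀ j → rowSum H j ≡ s)

block : {n : ℕ} → Matrix n → Matrix n → Matrix n → Matrix n → Matrix (n Data.Nat.+ n)
block {n} A B C D j k with splitAt n j | splitAt n k
... | inj₁ j' | inj₁ k' = A j' k'
... | inj₁ j' | inj₂ k' = B j' k'
... | inj₂ j' | inj₁ k' = C j' k'
... | inj₂ j' | inj₂ k' = D j' k'

Kmat : {n : ℕ} → Matrix n → Matrix (n Data.Nat.+ n)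
Kmat H = block H (scale iᵍ H) (scale iᵍ (H *)) (H *)

-- Skewness says H + H* = 2I, so every row of H* sums to 2 − s, where s = a + bi.
-- The sum of all entries of H* is the conjugate of that of H, namely n·s̄, so
-- n(2 − s) = n·s̄; when n > 0 this gives 2 − s = s̄ (that is, a = 1), and H* is
-- regular with row sum s̄. The rows of K therefore sum to (1 + i)s or (1 + i)s̄.
module Submission where

open import Defs
open import Algebra.Bundles using (AbelianGroup)
open import Data.Fin using (Fin; zero; suc; splitAt; _↑ˡ_; _↑ʳ_)
open import Data.Fin.Properties using (splitAt-↑ˡ; splitAt-↑ʳ; splitAt⁻¹-↑ˡ; splitAt⁻¹-↑ʳ)
open import Data.Integer using (ℤ; _+_; _-_; _*_; +_; -_; 0ℤ; 1ℤ)
import Data.Integer.Properties as ℤ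
open import Data.Integer.Tactic.RingSolver using (solve-∀)
open import Data.Nat using (ℕ; zero; suc)
open import Data.Product using (_,_; ∃-syntax)
open import Data.Sum using (_⊎_; inj₁; inj₂)
open import Data.Vec.Functional using (replicate)
open import Function using (_∘_)
open import Level using (0ℓ)
open import Relation.Binary.PropositionalEquality
  using (_≡_; refl; sym; trans; cong; cong₂; isEquivalence)
open Relation.Binary.PropositionalEquality.≡-Reasoning

⊕-assoc : ∀ x y z → (x ⊕ y) ⊕ z ≡ x ⊕ (y ⊕ z)
⊕-assoc ⟨ a , b ⟩ ⟨ c , d ⟩ ⟨ e , f ⟩ = cong₂ ⟨_,_⟩ (ℤ.+-assoc a c e) (ℤ.+-assoc b d f)

⊕-comm : ∀ x y → x ⊕ y ≡ y ⊕ x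
⊕-comm ⟨ a , b ⟩ ⟨ c , d ⟩ = cong₂ ⟨_,_⟩ (ℤ.+-comm a c) (ℤ.+-comm b d)

⊕-identityˡ : ∀ x → 0ᵍ ⊕ x ≡ x
⊕-identityˡ ⟨ a , b ⟩ = cong₂ ⟨_,_⟩ (ℤ.+-identityˡ a) (ℤ.+-identityˡ b)

⊕-identityʳ : ∀ x → x ⊕ 0ᵍ ≡ x
⊕-identityʳ ⟨ a , b ⟩ = cong₂ ⟨_,_⟩ (ℤ.+-identityʳ a) (ℤ.+-identityʳ b)

⊕-inverseˡ : ∀ x → neg x ⊕ x ≡ 0ᵍ
⊕-inverseˡ ⟨ a , b ⟩ = cong₂ ⟨_,_⟩ (ℤ.+-inverseˡ a) (ℤ.+-inverseˡ b)

⊕-inverseʳ : ∀ x → x ⊕ neg x ≡ 0ᵍ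
⊕-inverseʳ ⟨ a , b ⟩ = cong₂ ⟨_,_⟩ (ℤ.+-inverseʳ a) (ℤ.+-inverseʳ b)

⊕-0ᵍ-abelianGroup : AbelianGroup 0ℓ 0ℓ
⊕-0ᵍ-abelianGroup = record
  { isAbelianGroup = record
    { isGroup = record
      { isMonoid = record
        { isSemigroup = record
          { isMagma = record { isEquivalence = isEquivalence ; ∙-cong = cong₂ _⊕_ }
          ; assoc = ⊕-assoc
          }
        ; identity = ⊕-identityˡ , ⊕-identityʳ
        }
      ; inverse = ⊕-inverseˡ , ⊕-inverseʳ
      ; ⁻¹-cong = cong neg
      }
    ; comm = ⊕-comm
    }
  }

open import Algebra.Properties.Group (AbelianGroup.group ⊕-0ᵍ-abelianGroup) using (∙-cancelʳ)
open import Algebra.Properties.CommutativeMonoid.Sum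
  (AbelianGroup.commutativeMonoid ⊕-0ᵍ-abelianGroup)
  using (sum; sum-cong-≗; ∑-distrib-+; ∑-comm; sum-replicate-zero)

conj-⊕ : ∀ x y → conj (x ⊕ y) ≡ conj x ⊕ conj y
conj-⊕ ⟨ a , b ⟩ ⟨ c , d ⟩ = cong ⟨ a + c ,_⟩ (ℤ.neg-distrib-+ b d)

⊗-zeroʳ : ∀ c → c ⊗ 0ᵍ ≡ 0ᵍ
⊗-zeroʳ ⟨ p , q ⟩ = cong₂ ⟨_,_⟩ (re-part p q) (im-part p q)
  where
  re-part : ∀ p q → p * 0ℤ - q * 0ℤ ≡ 0ℤ
  re-part = solve-∀
  im-part : ∀ p q → p * 0ℤ + q * 0ℤ ≡ 0ℤ
  im-part = solve-∀

⊗-distribˡ-⊕ : ∀ c x y → c ⊗ (x ⊕ y) ≡ c ⊗ x ⊕ c ⊗ y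
⊗-distribˡ-⊕ ⟨ p , q ⟩ ⟨ a , b ⟩ ⟨ e , f ⟩ =
  cong₂ ⟨_,_⟩ (re-part p q a b e f) (im-part p q a b e f)
  where
  re-part : ∀ p q a b e f → p * (a + e) - q * (b + f) ≡ (p * a - q * b) + (p * e - q * f)
  re-part = solve-∀
  im-part : ∀ p q a b e f → p * (b + f) + q * (a + e) ≡ (p * b + q * a) + (p * f + q * e)
  im-part = solve-∀

conj-skew : ∀ x y d e → conj (x ⊕ neg d) ≡ neg (y ⊕ neg e) → conj x ⊕ y ≡ conj d ⊕ e
conj-skew x y d e h = begin
  conj x ⊕ y                       ≡⟨ expand x y d ⟩
  conj (x ⊕ neg d) ⊕ (y ⊕ conj d)  ≡⟨ cong (_⊕ (y ⊕ conj d)) h ⟩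
  neg (y ⊕ neg e) ⊕ (y ⊕ conj d)   ≡⟨ contract y d e ⟩
  conj d ⊕ e                       ∎
  where
  expand : ∀ x y d → conj x ⊕ y ≡ conj (x ⊕ neg d) ⊕ (y ⊕ conj d)
  expand ⟨ p , q ⟩ ⟨ u , v ⟩ ⟨ d₁ , d₂ ⟩ =
    cong₂ ⟨_,_⟩ (re-part p u d₁) (im-part q v d₂)
    where
    re-part : ∀ p u d → p + u ≡ (p + - d) + (u + d)
    re-part = solve-∀
    im-part : ∀ q v d → - q + v ≡ - (q + - d) + (v + - d)
    im-part = solve-∀
  contract : ∀ y d e → neg (y ⊕ neg e) ⊕ (y ⊕ conj d) ≡ conj d ⊕ e
  contract ⟨ u , v ⟩ ⟨ d₁ , d₂ ⟩ ⟨ e₁ , e₂ ⟩ =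
    cong₂ ⟨_,_⟩ (re-part u d₁ e₁) (im-part v d₂ e₂)
    where
    re-part : ∀ u d e → - (u + - e) + (u + d) ≡ d + e
    re-part = solve-∀
    im-part : ∀ v d e → - (v + - e) + (v + - d) ≡ - d + e
    im-part = solve-∀

⊕-iᵍ⊗-self : ∀ a b → ⟨ a , b ⟩ ⊕ iᵍ ⊗ ⟨ a , b ⟩ ≡ ⟨ a - b , a + b ⟩
⊕-iᵍ⊗-self a b = cong₂ ⟨_,_⟩ (re-part a b) (im-part a b)
  where
  re-part : ∀ a b → a + (0ℤ * a - 1ℤ * b) ≡ a - b
  re-part = solve-∀
  im-part : ∀ a b → b + (0ℤ * b + 1ℤ * a) ≡ a + b
  im-part = solve-∀

iᵍ⊗-conj-⊕-conj : ∀ a b → iᵍ ⊗ conj ⟨ a , b ⟩ ⊕ conj ⟨ a , b ⟩ ≡ ⟨ a + b , a - b ⟩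
iᵍ⊗-conj-⊕-conj a b = cong₂ ⟨_,_⟩ (re-part a b) (im-part a b)
  where
  re-part : ∀ a b → (0ℤ * a - 1ℤ * (- b)) + a ≡ a + b
  re-part = solve-∀
  im-part : ∀ a b → (0ℤ * (- b) + 1ℤ * a) + - b ≡ a - b
  im-part = solve-∀

conj-δ : ∀ {n} (j k : Fin n) → conj (δ j k) ≡ δ k j
conj-δ zero    zero    = refl
conj-δ zero    (suc k) = refl
conj-δ (suc j) zero    = refl
conj-δ (suc j) (suc k) = conj-δ j k

sumᵍ≡sum : ∀ n (f : Fin n → ℤ[i]) → sumᵍ n f ≡ sum f
sumᵍ≡sum zero    f = refl
sumᵍ≡sum (suc n) f = cong (f zero ⊕_) (sumᵍ≡sum n (f ∘ suc))

sum-hom : (φ : ℤ[i] → ℤ[i]) → φ 0ᵍ ≡ 0ᵍ → (∀ x y → φ (x ⊕ y) ≡ φ x ⊕ φ y) →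
          ∀ {n} (f : Fin n → ℤ[i]) → sum (φ ∘ f) ≡ φ (sum f)
sum-hom φ φ-0 φ-⊕ {zero}  f = sym φ-0
sum-hom φ φ-0 φ-⊕ {suc n} f =
  trans (cong (φ (f zero) ⊕_) (sum-hom φ φ-0 φ-⊕ (f ∘ suc))) (sym (φ-⊕ (f zero) _))

sum-replicate-re-im : ∀ n x → sum (replicate n x) ≡ ⟨ + n * re x , + n * im x ⟩
sum-replicate-re-im zero    x = refl
sum-replicate-re-im (suc n) x =
  trans (cong (x ⊕_) (sum-replicate-re-im n x))
        (cong₂ ⟨_,_⟩ (suc-* (re x) (+ n)) (suc-* (im x) (+ n)))
  where
  suc-* : ∀ a m → a + m * a ≡ (+ 1 + m) * a
  suc-* = solve-∀

sum-replicate-injective : ∀ {n x y} → Fin n → sum (replicate n x) ≡ sum (replicate n y) → x ≡ y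
sum-replicate-injective {suc n} {x} {y} _ eq =
  cong₂ ⟨_,_⟩ (ℤ.*-cancelˡ-≡ (+ suc n) _ _ (cong re eq′))
              (ℤ.*-cancelˡ-≡ (+ suc n) _ _ (cong im eq′))
  where
  eq′ : ⟨ + suc n * re x , + suc n * im x ⟩ ≡ ⟨ + suc n * re y , + suc n * im y ⟩
  eq′ = trans (sym (sum-replicate-re-im (suc n) x)) (trans eq (sum-replicate-re-im (suc n) y))

sum-conj : ∀ {n} (f : Fin n → ℤ[i]) → sum (conj ∘ f) ≡ conj (sum f)
sum-conj = sum-hom conj refl conj-⊕

sum-⊗ : ∀ c {n} (f : Fin n → ℤ[i]) → sum (λ k → c ⊗ f k) ≡ c ⊗ sum f
sum-⊗ c = sum-hom (c ⊗_) (⊗-zeroʳ c) (⊗-distribˡ-⊕ c)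

sum-δ : ∀ {n} (j : Fin n) → sum (δ j) ≡ 1ᵍ
sum-δ {suc n} zero    = trans (cong (1ᵍ ⊕_) (sum-replicate-zero n)) (⊕-identityʳ 1ᵍ)
sum-δ {suc n} (suc j) = trans (⊕-identityˡ _) (sum-δ j)

sum-split : ∀ m n (f : Fin (m Data.Nat.+ n) → ℤ[i]) →
            sum f ≡ sum (f ∘ (_↑ˡ n)) ⊕ sum (f ∘ (m ↑ʳ_))
sum-split zero    n f = sym (⊕-identityˡ _)
sum-split (suc m) n f =
  trans (cong (f zero ⊕_) (sum-split m n (f ∘ suc))) (sym (⊕-assoc (f zero) _ _))

↑ˡ-or-↑ʳ : ∀ m {n} (r : Fin (m Data.Nat.+ n)) → (∃[ j ] j ↑ˡ n ≡ r) ⊎ (∃[ j ] m ↑ʳ j ≡ r)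
↑ˡ-or-↑ʳ m r with splitAt m r in split
... | inj₁ j = inj₁ (j , splitAt⁻¹-↑ˡ split)
... | inj₂ j = inj₂ (j , splitAt⁻¹-↑ʳ split)

rowSum-scale : ∀ {n} c (M : Matrix n) j → rowSum (scale c M) j ≡ c ⊗ rowSum M j
rowSum-scale {n} c M j = begin
  rowSum (scale c M) j   ≡⟨ sumᵍ≡sum n (scale c M j) ⟩
  sum (λ k → c ⊗ M j k)  ≡⟨ sum-⊗ c (M j) ⟩
  c ⊗ sum (M j)          ≡⟨ cong (c ⊗_) (sumᵍ≡sum n (M j)) ⟨
  c ⊗ rowSum M j         ∎

module _ {n} (A B C D : Matrix n) where

  block-↑ˡ-↑ˡ : ∀ j k → block A B C D (j ↑ˡ n) (k ↑ˡ n) ≡ A j k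
  block-↑ˡ-↑ˡ j k rewrite splitAt-↑ˡ n j n | splitAt-↑ˡ n k n = refl

  block-↑ˡ-↑ʳ : ∀ j k → block A B C D (j ↑ˡ n) (n ↑ʳ k) ≡ B j k
  block-↑ˡ-↑ʳ j k rewrite splitAt-↑ˡ n j n | splitAt-↑ʳ n n k = refl

  block-↑ʳ-↑ˡ : ∀ j k → block A B C D (n ↑ʳ j) (k ↑ˡ n) ≡ C j k
  block-↑ʳ-↑ˡ j k rewrite splitAt-↑ʳ n n j | splitAt-↑ˡ n k n = refl

  block-↑ʳ-↑ʳ : ∀ j k → block A B C D (n ↑ʳ j) (n ↑ʳ k) ≡ D j k
  block-↑ʳ-↑ʳ j k rewrite splitAt-↑ʳ n n j | splitAt-↑ʳ n n k = refl

  rowSum-block-↑ˡ : ∀ j → rowSum (block A B C D) (j ↑ˡ n) ≡ rowSum A j ⊕ rowSum B j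
  rowSum-block-↑ˡ j = begin
    rowSum (block A B C D) (j ↑ˡ n)
      ≡⟨ trans (sumᵍ≡sum _ _) (sum-split n n _) ⟩
    sum (λ k → block A B C D (j ↑ˡ n) (k ↑ˡ n)) ⊕ sum (λ k → block A B C D (j ↑ˡ n) (n ↑ʳ k))
      ≡⟨ cong₂ _⊕_ (sum-cong-≗ (block-↑ˡ-↑ˡ j)) (sum-cong-≗ (block-↑ˡ-↑ʳ j)) ⟩
    sum (A j) ⊕ sum (B j)
      ≡⟨ cong₂ _⊕_ (sumᵍ≡sum n (A j)) (sumᵍ≡sum n (B j)) ⟨
    rowSum A j ⊕ rowSum B j
      ∎

  rowSum-block-↑ʳ : ∀ j → rowSum (block A B C D) (n ↑ʳ j) ≡ rowSum C j ⊕ rowSum D j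
  rowSum-block-↑ʳ j = begin
    rowSum (block A B C D) (n ↑ʳ j)
      ≡⟨ trans (sumᵍ≡sum _ _) (sum-split n n _) ⟩
    sum (λ k → block A B C D (n ↑ʳ j) (k ↑ˡ n)) ⊕ sum (λ k → block A B C D (n ↑ʳ j) (n ↑ʳ k))
      ≡⟨ cong₂ _⊕_ (sum-cong-≗ (block-↑ʳ-↑ˡ j)) (sum-cong-≗ (block-↑ʳ-↑ʳ j)) ⟩
    sum (C j) ⊕ sum (D j)
      ≡⟨ cong₂ _⊕_ (sumᵍ≡sum n (C j)) (sumᵍ≡sum n (D j)) ⟨
    rowSum C j ⊕ rowSum D j
      ∎

module _ {n} (M : Matrix n) (skew : IsSkewType n M) where

  skew-*-⊕ : ∀ j k → (M *) j k ⊕ M j k ≡ δ j k ⊕ δ j k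
  skew-*-⊕ j k =
    trans (conj-skew (M k j) (M j k) (δ k j) (δ j k) (skew j k)) (cong (_⊕ δ j k) (conj-δ k j))

  skew-rowSum : ∀ j → rowSum (M *) j ⊕ rowSum M j ≡ 1ᵍ ⊕ 1ᵍ
  skew-rowSum j = begin
    rowSum (M *) j ⊕ rowSum M j    ≡⟨ cong₂ _⊕_ (sumᵍ≡sum n ((M *) j)) (sumᵍ≡sum n (M j)) ⟩
    sum ((M *) j) ⊕ sum (M j)      ≡⟨ ∑-distrib-+ ((M *) j) (M j) ⟨
    sum (λ k → (M *) j k ⊕ M j k)  ≡⟨ sum-cong-≗ (skew-*-⊕ j) ⟩
    sum (λ k → δ j k ⊕ δ j k)      ≡⟨ ∑-distrib-+ (δ j) (δ j) ⟩
    sum (δ j) ⊕ sum (δ j)          ≡⟨ cong₂ _⊕_ (sum-δ j) (sum-δ j) ⟩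
    1ᵍ ⊕ 1ᵍ                        ∎

sum-rowSum-* : ∀ {n} (M : Matrix n) → sum (rowSum (M *)) ≡ conj (sum (rowSum M))
sum-rowSum-* {n} M = begin
  sum (λ j → rowSum (M *) j)            ≡⟨ sum-cong-≗ (λ j → sumᵍ≡sum n ((M *) j)) ⟩
  sum (λ j → sum (λ k → conj (M k j)))  ≡⟨ ∑-comm (λ j k → conj (M k j)) ⟩
  sum (λ k → sum (λ j → conj (M k j)))  ≡⟨ sum-cong-≗ (λ k → sum-conj (M k)) ⟩
  sum (λ k → conj (sum (M k)))          ≡⟨ sum-conj (λ k → sum (M k)) ⟩
  conj (sum (λ k → sum (M k)))          ≡⟨ cong conj (sum-cong-≗ (λ k → sumᵍ≡sum n (M k))) ⟨
  conj (sum (rowSum M))                 ∎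

module _ {n} (M : Matrix n) {s} (skew : IsSkewType n M) (regular : ∀ j → rowSum M j ≡ s) where

  conj-s⊕s≡1ᵍ⊕1ᵍ : Fin n → conj s ⊕ s ≡ 1ᵍ ⊕ 1ᵍ
  conj-s⊕s≡1ᵍ⊕1ᵍ j = sum-replicate-injective j (begin
    sum (replicate n (conj s ⊕ s))
      ≡⟨ ∑-distrib-+ (replicate n (conj s)) (replicate n s) ⟩
    sum (replicate n (conj s)) ⊕ sum (replicate n s)
      ≡⟨ cong (_⊕ sum (replicate n s)) (sum-conj (replicate n s)) ⟩
    conj (sum (replicate n s)) ⊕ sum (replicate n s)
      ≡⟨ cong (λ σ → conj σ ⊕ σ) (sum-cong-≗ regular) ⟨
    conj (sum (rowSum M)) ⊕ sum (rowSum M)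
      ≡⟨ cong (_⊕ sum (rowSum M)) (sum-rowSum-* M) ⟨
    sum (rowSum (M *)) ⊕ sum (rowSum M)
      ≡⟨ ∑-distrib-+ (rowSum (M *)) (rowSum M) ⟨
    sum (λ j → rowSum (M *) j ⊕ rowSum M j)
      ≡⟨ sum-cong-≗ (skew-rowSum M skew) ⟩
    sum (replicate n (1ᵍ ⊕ 1ᵍ))
      ∎)

  rowSum-*≡conj-s : ∀ j → rowSum (M *) j ≡ conj s
  rowSum-*≡conj-s j = ∙-cancelʳ s (rowSum (M *) j) (conj s) (begin
    rowSum (M *) j ⊕ s            ≡⟨ cong (rowSum (M *) j ⊕_) (regular j) ⟨
    rowSum (M *) j ⊕ rowSum M j   ≡⟨ skew-rowSum M skew j ⟩
    1ᵍ ⊕ 1ᵍ                       ≡⟨ conj-s⊕s≡1ᵍ⊕1ᵍ j ⟨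
    conj s ⊕ s                    ∎)

rowSum-Kmat-↑ˡ : ∀ {n} (H : Matrix n) j →
                 rowSum (Kmat H) (j ↑ˡ n) ≡ rowSum H j ⊕ iᵍ ⊗ rowSum H j
rowSum-Kmat-↑ˡ H j = trans (rowSum-block-↑ˡ H (scale iᵍ H) (scale iᵍ (H *)) (H *) j)
                           (cong (rowSum H j ⊕_) (rowSum-scale iᵍ H j))

rowSum-Kmat-↑ʳ : ∀ {n} (H : Matrix n) j →
                 rowSum (Kmat H) (n ↑ʳ j) ≡ iᵍ ⊗ rowSum (H *) j ⊕ rowSum (H *) j
rowSum-Kmat-↑ʳ H j = trans (rowSum-block-↑ʳ H (scale iᵍ H) (scale iᵍ (H *)) (H *) j)
                           (cong (_⊕ rowSum (H *) j) (rowSum-scale iᵍ (H *) j))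

lemma4p7 : (a b : ℤ) (n : ℕ) (H : Matrix n) →
    + n ≡ a * a + b * b →
    IsSkewRegularQH n H ⟨ a , b ⟩ →
    ∀ (r : Fin (n Data.Nat.+ n)) →
      rowSum (Kmat H) r ≡ ⟨ a - b , a + b ⟩ ⊎ rowSum (Kmat H) r ≡ ⟨ a + b , a - b ⟩
lemma4p7 a b n H _ (_ , skew , regular) r with ↑ˡ-or-↑ʳ n r
... | inj₁ (j , refl) = inj₁ (begin
  rowSum (Kmat H) (j ↑ˡ n)              ≡⟨ rowSum-Kmat-↑ˡ H j ⟩
  rowSum H j ⊕ iᵍ ⊗ rowSum H j          ≡⟨ cong (λ σ → σ ⊕ iᵍ ⊗ σ) (regular j) ⟩
  ⟨ a , b ⟩ ⊕ iᵍ ⊗ ⟨ a , b ⟩            ≡⟨ ⊕-iᵍ⊗-self a b ⟩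
  ⟨ a - b , a + b ⟩                     ∎)
... | inj₂ (j , refl) = inj₂ (begin
  rowSum (Kmat H) (n ↑ʳ j)              ≡⟨ rowSum-Kmat-↑ʳ H j ⟩
  iᵍ ⊗ rowSum (H *) j ⊕ rowSum (H *) j  ≡⟨ cong (λ σ → iᵍ ⊗ σ ⊕ σ) H*-regular ⟩
  iᵍ ⊗ conj ⟨ a , b ⟩ ⊕ conj ⟨ a , b ⟩  ≡⟨ iᵍ⊗-conj-⊕-conj a b ⟩
  ⟨ a + b , a - b ⟩                     ∎)
  where
  H*-regular : rowSum (H *) j ≡ conj ⟨ a , b ⟩
  H*-regular = rowSum-*≡conj-s H skew regular j
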